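{- Let $H_1$ and $H_2$ be da-hypomorphs of a graph or digraph. Some pair of dacards (obtained by deleting distinct vertices) in their common dadeck is dapasted isomorphically in $H_1$ and $H_2$ if and only if every such pair of dacards in their common dadeck is dapasted isomorphically in $H_1$ and $H_2$.
   Context: Digraphs are finite, without loops or multiple arcs; a graph is regarded as a digraph in which every edge is a pair of opposite arcs. For a vertex $x$ of a digraph $D$, $\mathrm{dt}_D(x)=(a,b,c)$ where $a,b,c$ count vertices $w$ such that respectively only $xw$, only $wx$, both $xw,wx$ are arcs. A dacard of $D$ is a pair $(D-x,\mathrm{dt}_D(x))$, with $D-x$ up to isomorphism; $\mathrm{Dadeck}(D)$ is the multiset of dacards; digraphs with the same dadeck are da-hypomorphs. A dapasting of dacards $(A,\alpha),(B,\beta)$ of $G$ (from distinct vertices) as members of $\mathrm{Dadeck}(G)$ is a digraph $P$ with two distinct non-adjacent vertices $u,v$ labeled $(e,\alpha)$ and $(e,\beta)$ (others unlabeled), with $P-u\cong A$, $P-v\cong B$, such that some $Y\in\{P,P+uv,P+vu,P+uv+vu\}$ has $\mathrm{dt}_Y(u)=\alpha$, $\mathrm{dt}_Y(v)=\beta$ and is da-hypomorphic to $G$; digraphs isomorphic to such $Y$ are completions of $P$, and $P$ is a dapasting in $J$ if $J$ is a completion of $P$. Two dapastings are isomorphic if there is a label-preserving digraph isomorphism between them. Dacards $A,B$ are dapasted isomorphically in da-hypomorphs $H_1,H_2$ if there are a dapasting of $A,B$ in $H_1$ and a dapasting of $A,B$ in $H_2$ (as members of the common dadeck) that are isomorphic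 as dapastings. -}

module Defs where

open import Data.Nat using (ℕ; zero; suc; _+_)
open import Data.Fin using (Fin; zero; suc; punchIn; _≟_)
open import Data.Bool using (Bool; true; false; _∧_; _∨_; not; if_then_else_)
open import Data.Maybe using (Maybe; just; nothing)
open import Data.Product using (Σ; Σ-syntax; ∃; ∃-syntax; _×_; _,_)
open import Function.Bundles using (_↔_; Inverse)
open import Relation.Binary.PropositionalEquality using (_≡_; _≢_)
open import Relation.Nullary.Decidable using (⌊_⌋)

-- A (finite, loopless) digraph on the vertex set Fin n.
-- A graph is the special case of a symmetric arc relation.
record DG (n : ℕ) : Set where
  field
    arc      : Fin n → Fin n → Bool
    loopless : ∀ i → arc i i ≡ false
open DG public

record Iso {n : ℕ} (D E : DG n) : Set where
  field
    σ    : Fin n ↔ Fin n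
    pres : ∀ i j → arc D i j ≡ arc E (Inverse.to σ i) (Inverse.to σ j)

del : ∀ {n} → DG (suc n) → Fin (suc n) → DG n
del D x = record
  { arc      = λ i j → arc D (punchIn x i) (punchIn x j)
  ; loopless = λ i → loopless D (punchIn x i) }

countF : ∀ {n} → (Fin n → Bool) → ℕ
countF {zero}  p = 0
countF {suc n} p = (if p zero then 1 else 0) + countF (λ i → p (suc i))

Triple : Set
Triple = ℕ × ℕ × ℕ

dt : ∀ {n} → DG n → Fin n → Triple
dt D x =
  countF (λ w → arc D x w ∧ not (arc D w x)) ,
  countF (λ w → not (arc D x w) ∧ arc D w x) ,
  countF (λ w → arc D x w ∧ arc D w x)

-- Da-hypomorphism: equal dadecks (as multisets of dacards, each dacard
-- (D - x, dt_D(x)) taken with D - x up to isomorphism).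
DaHyp : ∀ {n} → DG (suc n) → DG (suc n) → Set
DaHyp {n} D E =
  Σ (Fin (suc n) ↔ Fin (suc n)) λ τ → ∀ x →
    Iso (del D x) (del E (Inverse.to τ x)) × (dt D x ≡ dt E (Inverse.to τ x))

label : ∀ {n} → Fin n → Fin n → Triple → Triple → Fin n → Maybe Triple
label u v α β w =
  if ⌊ w ≟ u ⌋ then just α else (if ⌊ w ≟ v ⌋ then just β else nothing)

record Dapasting {m : ℕ} (G J : DG (suc (suc m)))
                 (A : DG (suc m)) (α : Triple) (B : DG (suc m)) (β : Triple) : Set where
  field
    P      : DG (suc (suc m))
    u v    : Fin (suc (suc m))
    u≢v    : u ≢ v
    nonadj₁ : arc P u v ≡ false
    nonadj₂ : arc P v u ≡ false
    delu   : Iso (del P u) A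
    delv   : Iso (del P v) B
    -- Y ∈ {P, P+uv, P+vu, P+uv+vu}
    Y      : DG (suc (suc m))
    b₁ b₂  : Bool
    Yarc   : ∀ i j → arc Y i j ≡
               (arc P i j ∨ (b₁ ∧ ⌊ i ≟ u ⌋ ∧ ⌊ j ≟ v ⌋) ∨ (b₂ ∧ ⌊ i ≟ v ⌋ ∧ ⌊ j ≟ u ⌋))
    dtu    : dt Y u ≡ α
    dtv    : dt Y v ≡ β
    Yhyp   : DaHyp Y G
    -- J is a completion of P, i.e. J ≅ Y
    JY     : Iso J Y

LabIso : ∀ {m G₁ J₁ G₂ J₂ A α B β} →
         Dapasting {m} G₁ J₁ A α B β → Dapasting {m} G₂ J₂ A α B β → Set
LabIso {α = α} {β = β} d₁ d₂ =
  Σ (Iso (Dapasting.P d₁) (Dapasting.P d₂)) λ φ → ∀ w →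
    label (Dapasting.u d₁) (Dapasting.v d₁) α β w ≡
    label (Dapasting.u d₂) (Dapasting.v d₂) α β (Inverse.to (Iso.σ φ) w)

DapastedIso : ∀ {m} (G H₁ H₂ : DG (suc (suc m))) →
              DG (suc m) → Triple → DG (suc m) → Triple → Set
DapastedIso G H₁ H₂ A α B β =
  Σ (Dapasting G H₁ A α B β) λ d₁ → Σ (Dapasting G H₂ A α B β) λ d₂ → LabIso d₁ d₂

-- The pair of dacards of the common dadeck obtained by deleting x and y
-- (indexed via the vertices of H₁) is dapasted isomorphically in H₁, H₂.
PairDapastedIso : ∀ {m} (H₁ H₂ : DG (suc (suc m))) → (x y : Fin (suc (suc m))) → Set
PairDapastedIso H₁ H₂ x y =
  DapastedIso H₁ H₁ H₂ (del H₁ x) (dt H₁ x) (del H₁ y) (dt H₁ y)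

{-# OPTIONS --safe #-}
-- A label-preserving isomorphism φ between dapastings P₁ ≅ P₂ already forces
-- H₁ ≅ H₂: φ maps the labelled pair {u₁, v₁} onto {u₂, v₂}, so the completions
-- Y₁, Y₂ agree (via φ) on every arc except possibly u₁v₁ and v₁u₁.  Those two
-- arcs are recovered from the degree triple at u₁, which is the label α in
-- both completions: each of the three counts in dt changes by the indicator of
-- the missing arc class, so the classes of the pair u₁v₁ coincide.  Once
-- H₁ ≅ H₂, any pair of cards x ≠ y is dapasted isomorphically by deleting the
-- arcs between x and y in H₁ and using that same dapasting for H₂.
module Submission where

open import Defs
open import Data.Nat using (ℕ; suc; zero; _+_)
open import Data.Nat.Properties using (+-cancelʳ-≡; +-0-commutativeMonoid)
open import Data.Fin using (Fin; zero; suc; _≟_; punchIn)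
open import Data.Fin.Properties using (punchInᵢ≢i)
open import Data.Bool using (Bool; true; false; _∧_; _∨_; not; if_then_else_)
open import Data.Bool.Properties using (∧-identityʳ; ∧-zeroʳ; ∨-identityʳ; ∨-zeroʳ)
open import Data.Maybe using (just)
open import Data.Maybe.Properties using (just-injective)
open import Data.Product using (∃; ∃-syntax; _×_; _,_; proj₁; proj₂)
open import Data.Sum using (_⊎_; inj₁; inj₂; [_,_]′)
open import Data.Empty using (⊥-elim)
open import Function using (_∘_)
open import Function.Bundles using (_⇔_; _↔_; Inverse; mk⇔)
open import Function.Construct.Identity using (↔-id)
open import Function.Construct.Symmetry using (↔-sym)
open import Function.Construct.Composition using (_↔-∘_)
open import Relation.Binary.PropositionalEquality
open import Relation.Nullary using (¬_; yes; no)
open import Relation.Nullary.Decidable using (Dec; ⌊_⌋; _×-dec_; _⊎-dec_; dec-true; dec-false; isYes≗does)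
import Algebra.Properties.CommutativeMonoid.Sum as Sum

Iso-refl : ∀ {n} {D : DG n} → Iso D D
Iso-refl = record { σ = ↔-id _ ; pres = λ _ _ → refl }

Iso-sym : ∀ {n} {D E : DG n} → Iso D E → Iso E D
Iso-sym {E = E} I = record
  { σ    = ↔-sym σ
  ; pres = λ i j → trans (sym (cong₂ (arc E) (Inverse.strictlyInverseˡ σ i) (Inverse.strictlyInverseˡ σ j)))
                         (sym (pres (Inverse.from σ i) (Inverse.from σ j))) }
  where open Iso I

Iso-trans : ∀ {n} {D E F : DG n} → Iso D E → Iso E F → Iso D F
Iso-trans I J = record
  { σ    = Iso.σ J ↔-∘ Iso.σ I
  ; pres = λ i j → trans (Iso.pres I i j) (Iso.pres J _ _) }

pullback : ∀ {n} → (Fin n → Fin n) → DG n → DG n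
pullback s D = record
  { arc      = λ i j → arc D (s i) (s j)
  ; loopless = λ i → loopless D (s i) }

ind : Bool → ℕ
ind b = if b then 1 else 0

ind-injective : ∀ {a b} → ind a ≡ ind b → a ≡ b
ind-injective {false} {false} _ = refl
ind-injective {true}  {true}  _ = refl

open Sum +-0-commutativeMonoid using (sum; sum-permute; sum-remove)

countF-as-sum : ∀ {n} (p : Fin n → Bool) → countF p ≡ sum (ind ∘ p)
countF-as-sum {zero}  p = refl
countF-as-sum {suc n} p = cong (ind (p zero) +_) (countF-as-sum (p ∘ suc))

countF-cong : ∀ {n} {p q : Fin n → Bool} → (∀ w → p w ≡ q w) → countF p ≡ countF q
countF-cong {zero}  eq = refl
countF-cong {suc n} eq = cong₂ _+_ (cong ind (eq zero)) (countF-cong (eq ∘ suc))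

countF-permute : ∀ {n} (p : Fin n → Bool) (σ : Fin n ↔ Fin n) →
                 countF (p ∘ Inverse.to σ) ≡ countF p
countF-permute p σ = begin
  countF (p ∘ Inverse.to σ)   ≡⟨ countF-as-sum (p ∘ Inverse.to σ) ⟩
  sum (ind ∘ p ∘ Inverse.to σ) ≡⟨ sum-permute (ind ∘ p) σ ⟨
  sum (ind ∘ p)               ≡⟨ countF-as-sum p ⟨
  countF p                    ∎
  where open ≡-Reasoning

countF-punchIn : ∀ {n} (p : Fin (suc n) → Bool) v →
                 countF p ≡ ind (p v) + countF (p ∘ punchIn v)
countF-punchIn p v = begin
  countF p                             ≡⟨ countF-as-sum p ⟩
  sum (ind ∘ p)                        ≡⟨ sum-remove {i = v} (ind ∘ p) ⟩
  ind (p v) + sum (ind ∘ p ∘ punchIn v) ≡⟨ cong (ind (p v) +_) (countF-as-sum (p ∘ punchIn v)) ⟨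
  ind (p v) + countF (p ∘ punchIn v)   ∎
  where open ≡-Reasoning

countF-agree-off : ∀ {n} {p q : Fin (suc n) → Bool} v → (∀ w → w ≢ v → p w ≡ q w) →
                   countF p ≡ countF q → p v ≡ q v
countF-agree-off {p = p} {q} v agree eq = ind-injective (+-cancelʳ-≡ _ (ind (p v)) (ind (q v)) (begin
  ind (p v) + countF (p ∘ punchIn v) ≡⟨ countF-punchIn p v ⟨
  countF p                           ≡⟨ eq ⟩
  countF q                           ≡⟨ countF-punchIn q v ⟩
  ind (q v) + countF (q ∘ punchIn v) ≡⟨ cong (ind (q v) +_) (countF-cong (λ w → agree _ (punchInᵢ≢i v w))) ⟨
  ind (q v) + countF (p ∘ punchIn v) ∎))
  where open ≡-Reasoning

dt-pullback : ∀ {n} (σ : Fin n ↔ Fin n) (D : DG n) x →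
              dt (pullback (Inverse.to σ) D) x ≡ dt D (Inverse.to σ x)
dt-pullback σ D x =
  cong₂ _,_ (countF-permute (λ w → arc D s w ∧ not (arc D w s)) σ)
  (cong₂ _,_ (countF-permute (λ w → not (arc D s w) ∧ arc D w s) σ)
             (countF-permute (λ w → arc D s w ∧ arc D w s) σ))
  where s = Inverse.to σ x

∧-not-∨-∧ : ∀ a b → (a ∧ not b) ∨ (a ∧ b) ≡ a
∧-not-∨-∧ false b     = refl
∧-not-∨-∧ true  false = refl
∧-not-∨-∧ true  true  = refl

not-∧-∨-∧ : ∀ a b → (not a ∧ b) ∨ (a ∧ b) ≡ b
not-∧-∨-∧ false b     = ∨-identityʳ b
not-∧-∨-∧ true  b     = refl

pair-arcs-determined-by-dt : ∀ {n} {Y Z : DG (suc n)} {u v} →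
  (∀ w → w ≢ v → arc Y u w ≡ arc Z u w) → (∀ w → w ≢ v → arc Y w u ≡ arc Z w u) →
  dt Y u ≡ dt Z u → arc Y u v ≡ arc Z u v × arc Y v u ≡ arc Z v u
pair-arcs-determined-by-dt {Y = Y} {Z} {u} {v} row column dt≡ =
  trans (sym (∧-not-∨-∧ (arc Y u v) (arc Y v u))) (trans (cong₂ _∨_ outOnly both) (∧-not-∨-∧ (arc Z u v) (arc Z v u))) ,
  trans (sym (not-∧-∨-∧ (arc Y u v) (arc Y v u))) (trans (cong₂ _∨_ inOnly both) (not-∧-∨-∧ (arc Z u v) (arc Z v u)))
  where
  class : (f : Bool → Bool → Bool) →
          countF (λ w → f (arc Y u w) (arc Y w u)) ≡ countF (λ w → f (arc Z u w) (arc Z w u)) →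
          f (arc Y u v) (arc Y v u) ≡ f (arc Z u v) (arc Z v u)
  class f = countF-agree-off v (λ w w≢v → cong₂ f (row w w≢v) (column w w≢v))
  outOnly : arc Y u v ∧ not (arc Y v u) ≡ arc Z u v ∧ not (arc Z v u)
  outOnly = class (λ a b → a ∧ not b) (cong proj₁ dt≡)
  inOnly : not (arc Y u v) ∧ arc Y v u ≡ not (arc Z u v) ∧ arc Z v u
  inOnly  = class (λ a b → not a ∧ b) (cong (proj₁ ∘ proj₂) dt≡)
  both : arc Y u v ∧ arc Y v u ≡ arc Z u v ∧ arc Z v u
  both    = class _∧_ (cong (proj₂ ∘ proj₂) dt≡)

OnPair : ∀ {n} → Fin n → Fin n → Fin n → Fin n → Set
OnPair u v i j = (i ≡ u × j ≡ v) ⊎ (i ≡ v × j ≡ u)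

agree-off-pair⇒agree : ∀ {n} {Y Z : DG (suc n)} {u v} → u ≢ v →
  (∀ i j → ¬ OnPair u v i j → arc Y i j ≡ arc Z i j) → dt Y u ≡ dt Z u →
  ∀ i j → arc Y i j ≡ arc Z i j
agree-off-pair⇒agree {Y = Y} {Z} {u} {v} u≢v off dt≡ = agree
  where
  pairArcs : arc Y u v ≡ arc Z u v × arc Y v u ≡ arc Z v u
  pairArcs = pair-arcs-determined-by-dt {Y = Y} {Z}
    (λ w w≢v → off u w λ { (inj₁ (_ , w≡v)) → w≢v w≡v ; (inj₂ (u≡v , _)) → u≢v u≡v })
    (λ w w≢v → off w u λ { (inj₁ (_ , u≡v)) → u≢v u≡v ; (inj₂ (w≡v , _)) → w≢v w≡v })
    dt≡
  agree : ∀ i j → arc Y i j ≡ arc Z i j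
  agree i j with (i ≟ u ×-dec j ≟ v) ⊎-dec (i ≟ v ×-dec j ≟ u)
  ... | no ¬pair                 = off i j ¬pair
  ... | yes (inj₁ (refl , refl)) = proj₁ pairArcs
  ... | yes (inj₂ (refl , refl)) = proj₂ pairArcs

OnPair⇒≢ : ∀ {n} {u v i j : Fin n} → u ≢ v → OnPair u v i j → i ≢ j
OnPair⇒≢ u≢v (inj₁ (refl , refl)) = u≢v
OnPair⇒≢ u≢v (inj₂ (refl , refl)) = u≢v ∘ sym

Endpoint : ∀ {n} → Fin n → Fin n → Fin n → Set
Endpoint u v w = w ≡ u ⊎ w ≡ v

OnPair⇒Endpoints : ∀ {n} {u v i j : Fin n} → OnPair u v i j → Endpoint u v i × Endpoint u v j
OnPair⇒Endpoints (inj₁ (i≡u , j≡v)) = inj₁ i≡u , inj₂ j≡v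
OnPair⇒Endpoints (inj₂ (i≡v , j≡u)) = inj₂ i≡v , inj₁ j≡u

Endpoints⇒OnPair : ∀ {n} {u v i j : Fin n} → Endpoint u v i → Endpoint u v j → i ≢ j → OnPair u v i j
Endpoints⇒OnPair (inj₁ i≡u) (inj₁ j≡u) i≢j = ⊥-elim (i≢j (trans i≡u (sym j≡u)))
Endpoints⇒OnPair (inj₁ i≡u) (inj₂ j≡v) _   = inj₁ (i≡u , j≡v)
Endpoints⇒OnPair (inj₂ i≡v) (inj₁ j≡u) _   = inj₂ (i≡v , j≡u)
Endpoints⇒OnPair (inj₂ i≡v) (inj₂ j≡v) i≢j = ⊥-elim (i≢j (trans i≡v (sym j≡v)))

OnPair-meets-Endpoint : ∀ {n} {u v z i j : Fin n} → Endpoint u v z → OnPair u v i j → i ≡ z ⊎ j ≡ z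
OnPair-meets-Endpoint (inj₁ refl) (inj₁ (i≡u , _)) = inj₁ i≡u
OnPair-meets-Endpoint (inj₁ refl) (inj₂ (_ , j≡u)) = inj₂ j≡u
OnPair-meets-Endpoint (inj₂ refl) (inj₁ (_ , j≡v)) = inj₂ j≡v
OnPair-meets-Endpoint (inj₂ refl) (inj₂ (i≡v , _)) = inj₁ i≡v

⌊⌋-yes : ∀ {a} {A : Set a} (a? : Dec A) → A → ⌊ a? ⌋ ≡ true
⌊⌋-yes a? a = trans (isYes≗does a?) (dec-true a? a)

⌊⌋-no : ∀ {a} {A : Set a} (a? : Dec A) → ¬ A → ⌊ a? ⌋ ≡ false
⌊⌋-no a? ¬a = trans (isYes≗does a?) (dec-false a? ¬a)

label-at-u : ∀ {n} (u v : Fin n) {α β} → label u v α β u ≡ just α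
label-at-u u v rewrite ⌊⌋-yes (u ≟ u) refl = refl

label-at-v : ∀ {n} {u v : Fin n} {α β} → u ≢ v → label u v α β v ≡ just β
label-at-v {u = u} {v} u≢v rewrite ⌊⌋-no (v ≟ u) (u≢v ∘ sym) | ⌊⌋-yes (v ≟ v) refl = refl

label-endpoint : ∀ {n} {u v w : Fin n} {α β} → u ≢ v → Endpoint u v w → ∃[ γ ] label u v α β w ≡ just γ
label-endpoint {u = u} {v} _   (inj₁ refl) = _ , label-at-u u v
label-endpoint             u≢v (inj₂ refl) = _ , label-at-v u≢v

label-just : ∀ {n} {u v w : Fin n} {α β γ} → label u v α β w ≡ just γ →
             (w ≡ u × α ≡ γ) ⊎ (w ≡ v × β ≡ γ)
label-just {u = u} {v} {w} eq with w ≟ u | w ≟ v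
... | yes w≡u | _       = inj₁ (w≡u , just-injective eq)
... | no _    | yes w≡v = inj₂ (w≡v , just-injective eq)
... | no _    | no _    with () ← eq

label-just⇒Endpoint : ∀ {n} {u v w : Fin n} {α β γ} → label u v α β w ≡ just γ → Endpoint u v w
label-just⇒Endpoint eq with label-just eq
... | inj₁ (w≡u , _) = inj₁ w≡u
... | inj₂ (w≡v , _) = inj₂ w≡v

-- Definitionally the flag in Dapasting.Yarc, so Yarc can be stated with it.
atArc : ∀ {n} → Fin n → Fin n → Fin n → Fin n → Bool
atArc u v i j = ⌊ i ≟ u ⌋ ∧ ⌊ j ≟ v ⌋

atArc-refl : ∀ {n} (u v : Fin n) → atArc u v u v ≡ true
atArc-refl u v rewrite ⌊⌋-yes (u ≟ u) refl | ⌊⌋-yes (v ≟ v) refl = refl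

atArc-false : ∀ {n} {u v i j : Fin n} → ¬ (i ≡ u × j ≡ v) → atArc u v i j ≡ false
atArc-false {u = u} {v} {i} {j} ¬arc with i ≟ u | j ≟ v
... | no _    | _       = refl
... | yes _   | no _    = refl
... | yes i≡u | yes j≡v = ⊥-elim (¬arc (i≡u , j≡v))

module _ {m} {G J : DG (suc (suc m))} {A α B β} (d : Dapasting G J A α B β) where
  open Dapasting d

  completion-off-pair : ∀ i j → ¬ OnPair u v i j → arc Y i j ≡ arc P i j
  completion-off-pair i j ¬pair
    rewrite Yarc i j | atArc-false {u = u} {v} (¬pair ∘ inj₁) | atArc-false {u = v} {u} (¬pair ∘ inj₂)
          | ∧-zeroʳ b₁ | ∧-zeroʳ b₂ = ∨-identityʳ (arc P i j)

  label-just⇒dt : ∀ {w γ} → label u v α β w ≡ just γ → dt Y w ≡ γ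
  label-just⇒dt {w} eq with label-just {u = u} {v} {w} eq
  ... | inj₁ (refl , refl) = dtu
  ... | inj₂ (refl , refl) = dtv

module _ {m} {G₁ J₁ G₂ J₂ : DG (suc (suc m))} {A α B β}
         (d₁ : Dapasting G₁ J₁ A α B β) (d₂ : Dapasting G₂ J₂ A α B β) where
  private
    module D₁ = Dapasting d₁
    module D₂ = Dapasting d₂

  LabIso⇒Iso-completions : LabIso d₁ d₂ → Iso D₁.Y D₂.Y
  LabIso⇒Iso-completions (φ , labels) = record
    { σ = Iso.σ φ ; pres = agree-off-pair⇒agree {Y = D₁.Y} {pullback s D₂.Y} D₁.u≢v agree-off-pair dt-at-u }
    where
    s : Fin (suc (suc m)) → Fin (suc (suc m))
    s = Inverse.to (Iso.σ φ)

    Endpoint-reflected : ∀ i → Endpoint D₂.u D₂.v (s i) → Endpoint D₁.u D₁.v i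
    Endpoint-reflected i e = label-just⇒Endpoint (trans (labels i) (proj₂ (label-endpoint D₂.u≢v e)))

    OnPair-reflected : ∀ i j → OnPair D₂.u D₂.v (s i) (s j) → OnPair D₁.u D₁.v i j
    OnPair-reflected i j pair =
      Endpoints⇒OnPair (Endpoint-reflected i (proj₁ ends)) (Endpoint-reflected j (proj₂ ends))
                       (OnPair⇒≢ D₂.u≢v pair ∘ cong s)
      where ends = OnPair⇒Endpoints pair

    agree-off-pair : ∀ i j → ¬ OnPair D₁.u D₁.v i j → arc D₁.Y i j ≡ arc (pullback s D₂.Y) i j
    agree-off-pair i j ¬pair = begin
      arc D₁.Y i j         ≡⟨ completion-off-pair d₁ i j ¬pair ⟩
      arc D₁.P i j         ≡⟨ Iso.pres φ i j ⟩
      arc D₂.P (s i) (s j) ≡⟨ completion-off-pair d₂ (s i) (s j) (¬pair ∘ OnPair-reflected i j) ⟨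
      arc D₂.Y (s i) (s j) ∎
      where open ≡-Reasoning

    dt-at-u : dt D₁.Y D₁.u ≡ dt (pullback s D₂.Y) D₁.u
    dt-at-u = begin
      dt D₁.Y D₁.u                ≡⟨ D₁.dtu ⟩
      α                           ≡⟨ label-just⇒dt d₂ (trans (sym (labels D₁.u)) (label-at-u D₁.u D₁.v)) ⟨
      dt D₂.Y (s D₁.u)            ≡⟨ dt-pullback (Iso.σ φ) D₂.Y D₁.u ⟨
      dt (pullback s D₂.Y) D₁.u   ∎
      where open ≡-Reasoning

  LabIso⇒Iso : LabIso d₁ d₂ → Iso J₁ J₂
  LabIso⇒Iso li = Iso-trans D₁.JY (Iso-trans (LabIso⇒Iso-completions li) (Iso-sym D₂.JY))

completion-off-pair-bool : ∀ a b c → a ≡ a ∨ (b ∧ false) ∨ (c ∧ false)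
completion-off-pair-bool a b c rewrite ∧-zeroʳ b | ∧-zeroʳ c = sym (∨-identityʳ a)

completion-at-uv-bool : ∀ a b → a ≡ false ∨ (a ∧ true) ∨ (b ∧ false)
completion-at-uv-bool a b rewrite ∧-identityʳ a | ∧-zeroʳ b = sym (∨-identityʳ a)

completion-at-vu-bool : ∀ a b → b ≡ false ∨ (a ∧ false) ∨ (b ∧ true)
completion-at-vu-bool a b rewrite ∧-zeroʳ a = sym (∧-identityʳ b)

removePair : ∀ {n} → DG n → Fin n → Fin n → DG n
removePair D x y = record
  { arc      = λ i j → arc D i j ∧ not (atArc x y i j ∨ atArc y x i j)
  ; loopless = λ i → cong (λ a → a ∧ not (atArc x y i i ∨ atArc y x i i)) (loopless D i) }

module _ {n} (D : DG n) {x y : Fin n} where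

  removePair-off-pair : ∀ {i j} → ¬ OnPair x y i j → arc (removePair D x y) i j ≡ arc D i j
  removePair-off-pair {i} {j} ¬pair
    rewrite atArc-false {u = x} {y} (¬pair ∘ inj₁) | atArc-false {u = y} {x} (¬pair ∘ inj₂) = ∧-identityʳ (arc D i j)

  removePair-on-pair : ∀ {i j} → OnPair x y i j → arc (removePair D x y) i j ≡ false
  removePair-on-pair (inj₁ (refl , refl)) rewrite atArc-refl x y = ∧-zeroʳ (arc D x y)
  removePair-on-pair (inj₂ (refl , refl)) rewrite atArc-refl y x | ∨-zeroʳ (atArc x y y x) = ∧-zeroʳ (arc D y x)

  private
    Yarc-by-cases : ∀ {i j r e f} → arc (removePair D x y) i j ≡ r → atArc x y i j ≡ e → atArc y x i j ≡ f →
               arc D i j ≡ r ∨ (arc D x y ∧ e) ∨ (arc D y x ∧ f) →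
               arc D i j ≡ arc (removePair D x y) i j ∨ (arc D x y ∧ atArc x y i j) ∨ (arc D y x ∧ atArc y x i j)
    Yarc-by-cases refl refl refl eq = eq

  removePair-completion : x ≢ y → ∀ i j →
    arc D i j ≡ arc (removePair D x y) i j ∨ (arc D x y ∧ atArc x y i j) ∨ (arc D y x ∧ atArc y x i j)
  removePair-completion x≢y i j with (i ≟ x ×-dec j ≟ y) ⊎-dec (i ≟ y ×-dec j ≟ x)
  ... | no ¬pair =
    Yarc-by-cases (removePair-off-pair ¬pair) (atArc-false (¬pair ∘ inj₁)) (atArc-false (¬pair ∘ inj₂))
             (completion-off-pair-bool (arc D i j) (arc D x y) (arc D y x))
  ... | yes pair@(inj₁ (refl , refl)) =
    Yarc-by-cases (removePair-on-pair pair) (atArc-refl x y) (atArc-false (x≢y ∘ proj₁))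
             (completion-at-uv-bool (arc D x y) (arc D y x))
  ... | yes pair@(inj₂ (refl , refl)) =
    Yarc-by-cases (removePair-on-pair pair) (atArc-false {u = x} {y} (x≢y ∘ proj₂)) (atArc-refl y x)
             (completion-at-vu-bool (arc D x y) (arc D y x))

del-removePair : ∀ {n} (D : DG (suc n)) {x y z} → Endpoint x y z → Iso (del (removePair D x y) z) (del D z)
del-removePair D {z = z} e = record
  { σ    = ↔-id _
  ; pres = λ i j → removePair-off-pair D ([ punchInᵢ≢i z i , punchInᵢ≢i z j ]′ ∘ OnPair-meets-Endpoint e) }

DaHyp-refl : ∀ {n} (D : DG (suc n)) → DaHyp D D
DaHyp-refl D = ↔-id _ , λ x → Iso-refl {D = del D x} , refl

removePair-Dapasting : ∀ {m} {J} (D : DG (suc (suc m))) {x y} → x ≢ y → Iso J D →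
                       Dapasting D J (del D x) (dt D x) (del D y) (dt D y)
removePair-Dapasting D {x} {y} x≢y J≅D = record
  { P       = removePair D x y
  ; u       = x
  ; v       = y
  ; u≢v     = x≢y
  ; nonadj₁ = removePair-on-pair D (inj₁ (refl , refl))
  ; nonadj₂ = removePair-on-pair D (inj₂ (refl , refl))
  ; delu    = del-removePair D (inj₁ refl)
  ; delv    = del-removePair D (inj₂ refl)
  ; Y       = D
  ; b₁      = arc D x y
  ; b₂      = arc D y x
  ; Yarc    = removePair-completion D x≢y
  ; dtu     = refl
  ; dtv     = refl
  ; Yhyp    = DaHyp-refl D
  ; JY      = J≅D }

Iso⇒PairDapastedIso : ∀ {m} {H₁ H₂ : DG (suc (suc m))} → Iso H₂ H₁ →
                      ∀ {x y} → x ≢ y → PairDapastedIso H₁ H₂ x y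
Iso⇒PairDapastedIso {H₁ = H₁} H₂≅H₁ x≢y =
  removePair-Dapasting H₁ x≢y Iso-refl , removePair-Dapasting H₁ x≢y H₂≅H₁ , Iso-refl , λ _ → refl

corollary5p9 : ∀ {m : ℕ} (H₁ H₂ : DG (suc (suc m))) → DaHyp H₁ H₂ →
    (∃[ x ] ∃[ y ] (x ≢ y × PairDapastedIso H₁ H₂ x y))
      ⇔ (∀ x y → x ≢ y → PairDapastedIso H₁ H₂ x y)
corollary5p9 H₁ H₂ _ = mk⇔ every some
  where
  every : (∃[ x ] ∃[ y ] (x ≢ y × PairDapastedIso H₁ H₂ x y)) → ∀ x y → x ≢ y → PairDapastedIso H₁ H₂ x y
  every (_ , _ , _ , d₁ , d₂ , li) _ _ = Iso⇒PairDapastedIso (Iso-sym (LabIso⇒Iso d₁ d₂ li))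

  some : (∀ x y → x ≢ y → PairDapastedIso H₁ H₂ x y) → ∃[ x ] ∃[ y ] (x ≢ y × PairDapastedIso H₁ H₂ x y)
  some all = zero , suc zero , (λ ()) , all zero (suc zero) (λ ())
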